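{- For $n\ge 1$, the number of $\pi\in S_n$ avoiding both arrow patterns $(12;1\to 2)$ and $(1;1\to 1)$ equals the $n$-th 2-associated Bell number, i.e. the number of set partitions of $[n]$ with no singleton blocks.
   Context: Standard cycle form of $\sigma\in S_n$: product of disjoint cycles (fixed points included), each cycle starting with its largest element, cycles listed in increasing order of largest elements. The fundamental bijection $\theta:S_n\to S_n$ erases the parentheses of the standard cycle form to give a one-line permutation. For $\pi\in S_n$, $\hat\pi=\theta^{ -1}(\pi)$. An arrow pattern $(\nu;H)$ of size $k$: a string $\nu=a_1\dots a_m$ of positive integers and a set $H$ of arrows $b\to c$, with all integers appearing forming $[k]$. $\pi\in S_n$ contains $(\nu;H)$ if there is $X=\{x_1<\dots<x_k\}\subseteq[n]$ with positions $t_1<\dots<t_m$ such that $\pi_{t_1}\cdots\pi_{t_m}=x_{a_1}\cdots x_{a_m}$ and $\hat\pi(x_b)=x_c$ for every arrow $b\to c\in H$; otherwise it avoids it. In particular $\pi$ avoids $(1;1\to1)$ iff $\hat\pi$ has no fixed points. -}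

module Defs where

open import Data.Nat using (ℕ; zero; suc; _≡ᵇ_; _≤ᵇ_)
open import Data.Bool using (Bool; true; false; _∧_; not; if_then_else_)
open import Data.Product using (_×_; _,_)
open import Data.List using (List; []; _∷_; map; _++_; length; concat; concatMap; applyUpTo; filterᵇ)
open import Data.Bool.ListAction using (all; any)

range : ℕ → List ℕ
range n = applyUpTo suc n

_≡ᴸ_ : List ℕ → List ℕ → Bool
[] ≡ᴸ [] = true
[] ≡ᴸ (_ ∷ _) = false
(_ ∷ _) ≡ᴸ [] = false
(x ∷ xs) ≡ᴸ (y ∷ ys) = (x ≡ᵇ y) ∧ (xs ≡ᴸ ys)

elemᵇ : ℕ → List ℕ → Bool
elemᵇ x xs = any (x ≡ᵇ_) xs

-- All subsequences (order-preserving sublists) of a list; for an increasing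
-- list this enumerates each subset exactly once, as an increasing list.
sublists : {A : Set} → List A → List (List A)
sublists [] = [] ∷ []
sublists (x ∷ xs) = map (x ∷_) (sublists xs) ++ sublists xs

words : List ℕ → ℕ → List (List ℕ)
words A zero = [] ∷ []
words A (suc n) = concatMap (λ a → map (a ∷_) (words A n)) A

-- 1-indexed lookup: w at i is the i-th entry (0 if out of range).
at : List ℕ → ℕ → ℕ
at [] _ = 0
at (x ∷ xs) zero = 0
at (x ∷ xs) (suc zero) = x
at (x ∷ xs) (suc (suc i)) = at xs (suc i)

-- A permutation of [n] in one-line notation: a word of length n containing every
-- element of [n]; σ(i) = at σ i.
isPerm : ℕ → List ℕ → Bool
isPerm n w = (length w ≡ᵇ n) ∧ all (λ i → elemᵇ i w) (range n)

perms : ℕ → List (List ℕ)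
perms n = filterᵇ (isPerm n) (words (range n) n)

-- Cycle of σ through m, written m, σ(m), σ²(m), … (fuel = length σ suffices).
orbitFrom : ℕ → List ℕ → ℕ → ℕ → List ℕ
orbitFrom zero σ m c = []
orbitFrom (suc f) σ m c = if c ≡ᵇ m then [] else (c ∷ orbitFrom f σ m (at σ c))

cycleOf : List ℕ → ℕ → List ℕ
cycleOf σ m = m ∷ orbitFrom (length σ) σ m (at σ m)

isCycleMax : List ℕ → ℕ → Bool
isCycleMax σ m = all (λ c → c ≤ᵇ m) (cycleOf σ m)

-- Standard cycle form: each cycle starts with its largest element, cycles
-- listed in increasing order of largest elements (fixed points included).
standardCycleForm : List ℕ → List (List ℕ)
standardCycleForm σ = map (cycleOf σ) (filterᵇ (isCycleMax σ) (range (length σ)))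

θ : List ℕ → List ℕ
θ σ = concat (standardCycleForm σ)

-- hatSatisfies n π A : π̂ = θ⁻¹(π) satisfies π̂(b) = c for all (b , c) ∈ A,
-- i.e. there is σ ∈ S_n with θ(σ) = π and σ(b) = c for all (b , c) ∈ A
-- (θ is a bijection, so σ = π̂).
hatSatisfies : ℕ → List ℕ → List (ℕ × ℕ) → Bool
hatSatisfies n π A =
  any (λ σ → (θ σ ≡ᴸ π) ∧ all (λ { (b , c) → at σ b ≡ᵇ c }) A) (perms n)

record ArrowPattern : Set where
  field
    size : ℕ
    ν : List ℕ
    H : List (ℕ × ℕ)
open ArrowPattern public

-- π ∈ S_n contains (ν ; H): there is X = {x₁ < … < x_k} ⊆ [n] (an increasing list,
-- x_a = at X a) and positions t₁ < … < t_m (a subsequence of π) with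
-- π_{t₁}…π_{t_m} = x_{a₁}…x_{a_m}, and π̂(x_b) = x_c for each arrow b → c.
contains : ℕ → ArrowPattern → List ℕ → Bool
contains n p π =
  any (λ X → any (λ s → s ≡ᴸ map (at X) (ν p)) (sublists π)
             ∧ hatSatisfies n π (map (λ { (b , c) → (at X b , at X c) }) (H p)))
      (filterᵇ (λ X → length X ≡ᵇ size p) (sublists (range n)))

avoids : ℕ → ArrowPattern → List ℕ → Bool
avoids n p π = not (contains n p π)

pat12 : ArrowPattern
pat12 = record { size = 2 ; ν = 1 ∷ 2 ∷ [] ; H = (1 , 2) ∷ [] }

pat1 : ArrowPattern
pat1 = record { size = 1 ; ν = 1 ∷ [] ; H = (1 , 1) ∷ [] }

numAvoiders : ℕ → ℕ
numAvoiders n = length (filterᵇ (λ π → avoids n pat12 π ∧ avoids n pat1 π) (perms n))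

-- Subsets of [n] are increasing lists,
-- sets of subsets are sublists of the list of all subsets (each set once).
countᵇ : {A : Set} → (A → Bool) → List A → ℕ
countᵇ p xs = length (filterᵇ p xs)

isSetPartition : ℕ → List (List ℕ) → Bool
isSetPartition n F =
  all (λ B → 1 ≤ᵇ length B) F ∧ all (λ i → countᵇ (elemᵇ i) F ≡ᵇ 1) (range n)

noSingletonBlock : List (List ℕ) → Bool
noSingletonBlock F = all (λ B → 2 ≤ᵇ length B) F

bell2 : ℕ → ℕ
bell2 n = countᵇ (λ F → isSetPartition n F ∧ noSingletonBlock F) (sublists (sublists (range n)))

-- Cut π before each of its left-to-right maxima.  Every piece h t₁ … t_k is a cycle (h t₁ … t_k)
-- of π̂ = θ⁻¹(π), so π̂ has a fixed point iff some piece is a singleton, and π̂ has an arc a ↦ b with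
-- a < b and a to the left of b in π iff some piece has an ascent a b (the closing arc t_k ↦ h points
-- to the left).  Hence π avoids both patterns iff every piece is decreasing of length ≥ 2.
-- Reversing the pieces gives a partition of [n] into increasing blocks of size ≥ 2; conversely,
-- writing each block decreasingly and listing the blocks by increasing maximum recovers π.
module Submission where

open import Defs
open import Data.Bool.Base using (Bool; true; false; T; _∧_; not)
open import Data.Bool.ListAction using (all; any)
open import Data.Bool.Properties using (T-∧)
open import Data.Empty using (⊥; ⊥-elim)
open import Data.Nat.Base using (ℕ; zero; suc; _+_; _≤_; _<_; _>_; z≤n; s≤s; _≡ᵇ_; _≤ᵇ_)
open import Data.Nat.Properties using (_<?_)
import Data.Nat.Properties as ℕ
open import Data.Product using (_×_; _,_; proj₁; proj₂; ∃₂; ∃-syntax; uncurry)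
open import Data.Sum using (_⊎_; inj₁; inj₂)
open import Data.List.Base
  using (List; []; _∷_; [_]; _++_; map; concat; concatMap; length; filter; filterᵇ; reverse; applyUpTo;
         cartesianProductWith)
open import Data.List.Properties
  using (length-++-sucʳ; length-map; map-∘; map-id-local; filter-accept; filter-reject; ++-assoc; ++-identityʳ;
         ∷-injective; ∷-injectiveʳ; length-applyUpTo; map-concatMap; concatMap-cong; map-id;
         length-++; ≡-dec; unfold-reverse; reverse-involutive; length-reverse;
         reverse-injective; map-cong; map-++)
open import Data.List.Membership.Propositional using (_∈_; _∉_; find; lose)
open import Data.List.Membership.Propositional.Properties
  using (∈-map⁺; ∈-map⁻; ∈-++⁺ˡ; ∈-++⁺ʳ; ∈-++⁻; ∈-∃++; ∈-applyUpTo⁻;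
         ∈-cartesianProductWith⁺; ∈-cartesianProductWith⁻; ∈-filter⁺; ∈-filter⁻;
         ∈-concatMap⁺; ∈-concatMap⁻; ∈-concat⁻; ∈-concat⁺′)
open import Data.List.Relation.Unary.All as All using (All; []; _∷_)
open import Data.List.Relation.Unary.All.Properties.Core using (¬Any⇒All¬)
open import Data.List.Relation.Unary.All.Properties using (all⁺; all⁻; anti-mono)
  renaming (++⁺ to All-++⁺; map⁺ to All-map⁺)
open import Data.List.Relation.Unary.Any.Properties using (any⁺; any⁻; reverse⁺; reverse⁻)
open import Data.List.Relation.Unary.Any as Any using (Any; here; there)
open import Data.List.Relation.Unary.AllPairs as AllPairs using (AllPairs; []; _∷_)
import Data.List.Relation.Unary.AllPairs.Properties as AllPairs
open import Data.List.Relation.Unary.Unique.Propositional using (Unique)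
import Data.List.Relation.Unary.Unique.Propositional.Properties as Unique
open import Data.List.Relation.Binary.Subset.Propositional using (_⊆_)
open import Data.List.Relation.Binary.Disjoint.Propositional using (Disjoint)
open import Data.List.Relation.Binary.Sublist.Propositional
  using ([]; _∷_; _∷ʳ_; ⊆-refl; ⊆-trans; minimum; from∈; to∈) renaming (_⊆_ to _⊑_)
open import Data.List.Relation.Binary.Sublist.Propositional.Properties
  using (All-resp-⊆; Any-resp-⊆; ++⁺ˡ; ∷ˡ⁻; all⊆concat; length-mono-≤; filter-⊆)
open import Relation.Binary.Definitions using (Asymmetric; DecidableEquality)
open import Relation.Binary.PropositionalEquality
  using (_≡_; _≢_; refl; sym; trans; cong; cong₂; subst; subst₂; ≢-sym; module ≡-Reasoning)
open import Relation.Nullary using (¬_; yes; no; contradiction)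
open import Relation.Nullary.Decidable using (T?; dec-true; dec-false)
open import Relation.Unary using (Decidable)
open import Function.Base using (_∘_; _on_; case_of_; flip)
open import Function.Bundles using (Equivalence; _⇔_; mk⇔)
open Equivalence using (to; from)

private variable
  A B : Set
  x y : A
  xs ys : List A

AllPairs-resp-⊑ : ∀ {R : A → A → Set} → xs ⊑ ys → AllPairs R ys → AllPairs R xs
AllPairs-resp-⊑ [] [] = []
AllPairs-resp-⊑ (_ ∷ʳ τ) (_ ∷ rs) = AllPairs-resp-⊑ τ rs
AllPairs-resp-⊑ (refl ∷ τ) (r ∷ rs) = All-resp-⊆ τ r ∷ AllPairs-resp-⊑ τ rs

AllPairs-map-∈ : ∀ {R S : A → A → Set} → (∀ {x y} → x ∈ xs → y ∈ xs → R x y → S x y) →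
  AllPairs R xs → AllPairs S xs
AllPairs-map-∈ R⇒S [] = []
AllPairs-map-∈ R⇒S (Rx ∷ rs) =
    All.tabulate (λ y∈ → R⇒S (here refl) (there y∈) (All.lookup Rx y∈))
  ∷ AllPairs-map-∈ (λ x∈ y∈ → R⇒S (there x∈) (there y∈)) rs

AllPairs-reverse : ∀ {R : A → A → Set} → AllPairs R xs → AllPairs (flip R) (reverse xs)
AllPairs-reverse [] = []
AllPairs-reverse {xs = x ∷ xs} (Rx ∷ rs) = subst (AllPairs _) (sym (unfold-reverse x xs))
  (AllPairs.++⁺ (AllPairs-reverse rs) ([] ∷ []) (All.tabulate λ y∈ → All.lookup Rx (reverse⁻ y∈) ∷ []))

∷⊆∷⇒⊆ : ∀ {R : A → A → Set} → Asymmetric R → All (R x) xs → x ∷ xs ⊆ x ∷ ys → xs ⊆ ys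
∷⊆∷⇒⊆ asym Rx xs⊆ z∈ with xs⊆ (there z∈)
... | here refl  = contradiction (All.lookup Rx z∈) λ r → asym r r
... | there z∈ys = z∈ys

AllPairs-⊆⊇⇒head-≡ : ∀ {R : A → A → Set} → Asymmetric R → All (R x) xs → All (R y) ys →
  x ∷ xs ⊆ y ∷ ys → y ∷ ys ⊆ x ∷ xs → x ≡ y
AllPairs-⊆⊇⇒head-≡ asym Rx Ry xs⊆ ys⊆ with xs⊆ (here refl) | ys⊆ (here refl)
... | here x≡y   | _          = x≡y
... | there _    | here y≡x   = sym y≡x
... | there x∈ys | there y∈xs = contradiction (All.lookup Rx y∈xs) (asym (All.lookup Ry x∈ys))

⊆-antisym-AllPairs : ∀ {R : A → A → Set} → Asymmetric R → AllPairs R xs → AllPairs R ys →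
  xs ⊆ ys → ys ⊆ xs → xs ≡ ys
⊆-antisym-AllPairs asym [] [] _ _ = refl
⊆-antisym-AllPairs asym [] (_ ∷ _) _ ys⊆ = case ys⊆ (here refl) of λ ()
⊆-antisym-AllPairs asym (_ ∷ _) [] xs⊆ _ = case xs⊆ (here refl) of λ ()
⊆-antisym-AllPairs asym (Rx ∷ rxs) (Ry ∷ rys) xs⊆ ys⊆ with AllPairs-⊆⊇⇒head-≡ asym Rx Ry xs⊆ ys⊆
... | refl = cong (_ ∷_)
  (⊆-antisym-AllPairs asym rxs rys (∷⊆∷⇒⊆ asym Rx xs⊆) (∷⊆∷⇒⊆ asym Ry ys⊆))

increasing-⊆⇒⊑ : ∀ {xs ys : List ℕ} → AllPairs _<_ xs → AllPairs _<_ ys → xs ⊆ ys → xs ⊑ ys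
increasing-⊆⇒⊑ {ys = ys} [] _ _ = minimum ys
increasing-⊆⇒⊑ (_ ∷ _) [] xs⊆ = case xs⊆ (here refl) of λ ()
increasing-⊆⇒⊑ {x ∷ xs} {y ∷ ys} (x< ∷ inc-xs) (y< ∷ inc-ys) xs⊆ with xs⊆ (here refl)
... | here refl  = refl ∷ increasing-⊆⇒⊑ inc-xs inc-ys (∷⊆∷⇒⊆ ℕ.<-asym x< xs⊆)
... | there x∈ys = y ∷ʳ increasing-⊆⇒⊑ (x< ∷ inc-xs) inc-ys ⊆′
  where
  ⊆′ : x ∷ xs ⊆ ys
  ⊆′ (here refl) = x∈ys
  ⊆′ (there z∈xs) with xs⊆ (there z∈xs)
  ... | here refl  = contradiction (All.lookup x< z∈xs) (ℕ.<-asym (All.lookup y< x∈ys))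
  ... | there z∈ys = z∈ys

pair-⊑-antisym : ∀ {a b : A} {xs} → Unique xs → a ∷ b ∷ [] ⊑ xs → b ∷ a ∷ [] ⊑ xs → a ≡ b
pair-⊑-antisym (_ ∷ !xs)  (_ ∷ʳ ab⊑) (_ ∷ʳ ba⊑) = pair-⊑-antisym !xs ab⊑ ba⊑
pair-⊑-antisym (b≢ ∷ _)  (_ ∷ʳ ab⊑) (refl ∷ _)  = contradiction refl (All.lookup b≢ (to∈ (∷ˡ⁻ ab⊑)))
pair-⊑-antisym (a≢ ∷ _)  (refl ∷ _)  (_ ∷ʳ ba⊑) = contradiction refl (All.lookup a≢ (to∈ (∷ˡ⁻ ba⊑)))
pair-⊑-antisym _         (refl ∷ _)  (refl ∷ _)  = refl

filter-≡-sublist : ∀ {P : A → Set} (P? : Decidable P) {F S : List A} → F ⊑ S → Unique S →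
  (∀ {x} → x ∈ S → P x → x ∈ F) → All P F → filter P? S ≡ F
filter-≡-sublist P? [] _ _ _ = refl
filter-≡-sublist P? (y ∷ʳ τ) (y≢ ∷ !S) P⇒∈ PF =
  trans (filter-reject P? ¬Py) (filter-≡-sublist P? τ !S (P⇒∈ ∘ there) PF)
  where ¬Py = λ Py → All.lookup y≢ (Any-resp-⊆ τ (P⇒∈ (here refl) Py)) refl
filter-≡-sublist P? (refl ∷ τ) (y≢ ∷ !S) P⇒∈ (Py ∷ PF) =
  trans (filter-accept P? Py) (cong (_ ∷_) (filter-≡-sublist P? τ !S P⇒∈′ PF))
  where
  P⇒∈′ : ∀ {x} → x ∈ _ → _ → x ∈ _
  P⇒∈′ x∈S Px with P⇒∈ (there x∈S) Px
  ... | here refl = contradiction refl (All.lookup y≢ x∈S)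
  ... | there x∈F = x∈F

∈-sublists⁺ : xs ⊑ ys → xs ∈ sublists ys
∈-sublists⁺ [] = here refl
∈-sublists⁺ {ys = y ∷ ys} (y ∷ʳ τ) = ∈-++⁺ʳ (map (y ∷_) (sublists ys)) (∈-sublists⁺ τ)
∈-sublists⁺ (refl ∷ τ) = ∈-++⁺ˡ (∈-map⁺ (_ ∷_) (∈-sublists⁺ τ))

∈-sublists⁻ : ∀ ys → xs ∈ sublists ys → xs ⊑ ys
∈-sublists⁻ [] (here refl) = []
∈-sublists⁻ (y ∷ ys) xs∈ with ∈-++⁻ (map (y ∷_) (sublists ys)) xs∈
... | inj₂ xs∈ys = y ∷ʳ ∈-sublists⁻ ys xs∈ys
... | inj₁ xs∈y∷ with ∈-map⁻ (y ∷_) xs∈y∷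
...   | _ , zs∈ , refl = refl ∷ ∈-sublists⁻ ys zs∈

sublists-unique : Unique ys → Unique (sublists ys)
sublists-unique [] = [] ∷ []
sublists-unique {ys = y ∷ ys} (y≢ ∷ !ys) =
  Unique.++⁺ (Unique.map⁺ ∷-injectiveʳ (sublists-unique !ys)) (sublists-unique !ys) disjoint
  where
  disjoint : Disjoint (map (y ∷_) (sublists ys)) (sublists ys)
  disjoint (v∈₁ , v∈₂) with ∈-map⁻ (y ∷_) v∈₁
  ... | _ , _ , refl = All.lookup y≢ (Any-resp-⊆ (∈-sublists⁻ ys v∈₂) (here refl)) refl

∈-rotate⁺ : ∀ {h : A} t → x ∈ h ∷ t → x ∈ t ++ [ h ]
∈-rotate⁺ t (here refl) = ∈-++⁺ʳ t (here refl)
∈-rotate⁺ t (there x∈t) = ∈-++⁺ˡ x∈t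

∈-rotate⁻ : ∀ {h : A} t → x ∈ t ++ [ h ] → x ∈ h ∷ t
∈-rotate⁻ t x∈ with ∈-++⁻ t x∈
... | inj₁ x∈t         = there x∈t
... | inj₂ (here refl) = here refl

∈-++-insert : ∀ us {vs z} → z ∈ us ++ vs → z ∈ us ++ x ∷ vs
∈-++-insert us z∈ with ∈-++⁻ us z∈
... | inj₁ z∈us = ∈-++⁺ˡ z∈us
... | inj₂ z∈vs = ∈-++⁺ʳ us (there z∈vs)

unique-middle : ∀ us {vs} → Unique (us ++ x ∷ vs) → All (x ≢_) (us ++ vs) × Unique (us ++ vs)
unique-middle [] (x≢vs ∷ !vs) = x≢vs , !vs
unique-middle (u ∷ us) (u≢ ∷ !rest) with unique-middle us !rest
... | x≢ , !usvs = (λ x≡u → All.lookup u≢ (∈-++⁺ʳ us (here refl)) (sym x≡u)) ∷ x≢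
                 , All.tabulate (All.lookup u≢ ∘ ∈-++-insert us) ∷ !usvs

⊆-remove : ∀ us vs → xs ⊆ us ++ x ∷ vs → All (x ≢_) xs → xs ⊆ us ++ vs
⊆-remove us vs xs⊆ x≢xs z∈xs with ∈-++⁻ us (xs⊆ z∈xs)
... | inj₁ z∈us = ∈-++⁺ˡ z∈us
... | inj₂ (there z∈vs) = ∈-++⁺ʳ us z∈vs
... | inj₂ (here refl) = contradiction refl (All.lookup x≢xs z∈xs)

unique⊆⇒length≤ : Unique xs → xs ⊆ ys → length xs ≤ length ys
unique⊆⇒length≤ [] _ = z≤n
unique⊆⇒length≤ (x≢xs ∷ !xs) xs⊆ys with ∈-∃++ (xs⊆ys (here refl))
... | us , vs , refl = ℕ.≤-trans
  (s≤s (unique⊆⇒length≤ !xs (⊆-remove us vs (xs⊆ys ∘ there) x≢xs)))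
  (ℕ.≤-reflexive (sym (length-++-sucʳ us _ vs)))

module _ {A : Set} (_≟_ : DecidableEquality A) where

  open import Data.List.Membership.DecPropositional _≟_ using (_∈?_)

  unique⊆∧length≤⇒⊇ : {xs ys : List A} → Unique xs → xs ⊆ ys → length ys ≤ length xs → ys ⊆ xs
  unique⊆∧length≤⇒⊇ {xs} {ys} !xs xs⊆ys ys≤xs {y} y∈ys with y ∈? xs
  ... | yes y∈xs = y∈xs
  ... | no  y∉xs = contradiction
    (ℕ.≤-trans (unique⊆⇒length≤ (¬Any⇒All¬ xs y∉xs ∷ !xs) y∷xs⊆ys) ys≤xs) (ℕ.<-irrefl refl)
    where
    y∷xs⊆ys : y ∷ xs ⊆ ys
    y∷xs⊆ys (here refl)  = y∈ys
    y∷xs⊆ys (there z∈xs) = xs⊆ys z∈xs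

  unique⊆∧length≤⇒unique : {ys xs : List A} → Unique ys → ys ⊆ xs → length xs ≤ length ys → Unique xs
  unique⊆∧length≤⇒unique {xs = []} _ _ _ = []
  unique⊆∧length≤⇒unique {ys} {x ∷ xs} !ys ys⊆ xs<ys = ¬Any⇒All¬ xs x∉xs ∷ !xs
    where
    too-short : ys ⊆ xs → ⊥
    too-short ys⊆xs = ℕ.<-irrefl refl (ℕ.≤-trans xs<ys (unique⊆⇒length≤ !ys ys⊆xs))
    x∉xs : x ∉ xs
    x∉xs x∈xs = too-short λ z∈ys → case ys⊆ z∈ys of λ { (here refl) → x∈xs ; (there z∈xs) → z∈xs }
    !xs : Unique xs
    !xs with x ∈? ys
    ... | no x∉ys = ⊥-elim (too-short λ z∈ys →
            case ys⊆ z∈ys of λ { (here refl) → contradiction z∈ys x∉ys ; (there z∈xs) → z∈xs })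
    ... | yes x∈ys with ∈-∃++ x∈ys
    ... | us , vs , refl with unique-middle us !ys
    ... | x≢ , !usvs = unique⊆∧length≤⇒unique !usvs usvs⊆xs
            (ℕ.≤-pred (ℕ.≤-trans xs<ys (ℕ.≤-reflexive (length-++-sucʳ us x vs))))
      where
      usvs⊆xs : us ++ vs ⊆ xs
      usvs⊆xs z∈ with ys⊆ (∈-++-insert us z∈)
      ... | here refl = contradiction refl (All.lookup x≢ z∈)
      ... | there z∈xs = z∈xs

map-unique-of-retraction : {xs : List A} (f : A → B) (g : B → A) → Unique xs →
  (∀ {x} → x ∈ xs → g (f x) ≡ x) → Unique (map f xs)
map-unique-of-retraction {xs = xs} f g !xs g∘f≡id = Unique.map⁻ (subst Unique (sym g∘f∘xs) !xs)
  where
  g∘f∘xs : map g (map f xs) ≡ xs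
  g∘f∘xs = trans (sym (map-∘ xs)) (map-id-local (All.tabulate g∘f≡id))

length≤-of-retraction : {xs : List A} {ys : List B} (f : A → B) (g : B → A) → Unique xs →
  (∀ {x} → x ∈ xs → f x ∈ ys × g (f x) ≡ x) → length xs ≤ length ys
length≤-of-retraction {xs = xs} {ys} f g !xs f∈ = begin
  length xs          ≡⟨ length-map f xs ⟨
  length (map f xs)  ≤⟨ unique⊆⇒length≤ (map-unique-of-retraction f g !xs (proj₂ ∘ f∈)) fxs⊆ys ⟩
  length ys          ∎
  where
  open ℕ.≤-Reasoning
  fxs⊆ys : map f xs ⊆ ys
  fxs⊆ys z∈ with ∈-map⁻ f z∈
  ... | _ , x∈ , refl = proj₁ (f∈ x∈)

length-≡-of-inverses : {xs : List A} {ys : List B} (f : A → B) (g : B → A) → Unique xs → Unique ys →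
  (∀ {x} → x ∈ xs → f x ∈ ys × g (f x) ≡ x) → (∀ {y} → y ∈ ys → g y ∈ xs × f (g y) ≡ y) →
  length xs ≡ length ys
length-≡-of-inverses f g !xs !ys f∈ g∈ =
  ℕ.≤-antisym (length≤-of-retraction f g !xs f∈) (length≤-of-retraction g f !ys g∈)

length≡1⇒ : ∀ (X : List A) → length X ≡ 1 → ∃[ a ] X ≡ a ∷ []
length≡1⇒ (a ∷ []) _ = a , refl

length≡2⇒ : ∀ (X : List A) → length X ≡ 2 → ∃₂ λ a b → X ≡ a ∷ b ∷ []
length≡2⇒ (a ∷ b ∷ []) _ = a , b , refl

length-filter≡1⇒ : ∀ {P : A → Set} (P? : Decidable P) {xs} → length (filter P? xs) ≡ 1 →
  (∃[ x ] x ∈ xs × P x) × (∀ {x y} → x ∈ xs → y ∈ xs → P x → P y → x ≡ y)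
length-filter≡1⇒ {P = P} P? {xs} len with length≡1⇒ (filter P? xs) len
... | z , eq = (z , ∈-filter⁻ P? (subst (z ∈_) (sym eq) (here refl)))
             , λ x∈ y∈ Px Py → trans (only x∈ Px) (sym (only y∈ Py))
  where
  only : ∀ {x} → x ∈ xs → P x → x ≡ z
  only x∈ Px with subst (_ ∈_) eq (∈-filter⁺ P? x∈ Px)
  ... | here x≡z = x≡z

length-filter≡1⇐ : ∀ {P : A → Set} (P? : Decidable P) {xs x} → Unique xs → x ∈ xs → P x →
  (∀ {y} → y ∈ xs → P y → y ≡ x) → length (filter P? xs) ≡ 1
length-filter≡1⇐ P? {x = x} !xs x∈ Px only = ℕ.≤-antisym
  (unique⊆⇒length≤ {ys = x ∷ []} (Unique.filter⁺ P? !xs) (here ∘ uncurry only ∘ ∈-filter⁻ P?))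
  (unique⊆⇒length≤ ([] ∷ []) λ { (here refl) → ∈-filter⁺ P? x∈ Px })

at-most-one : Unique xs → (∀ {x y} → x ∈ xs → y ∈ xs → x ≡ y) → xs ≡ [] ⊎ ∃[ x ] xs ≡ x ∷ []
at-most-one {xs = []}         _ _ = inj₁ refl
at-most-one {xs = x ∷ []}     _ _ = inj₂ (x , refl)
at-most-one {xs = x ∷ y ∷ xs} ((x≢y ∷ _) ∷ _) same =
  contradiction (same (here refl) (there (here refl))) x≢y

unique-++⇒disjoint : ∀ (xs : List A) → Unique (xs ++ ys) → Disjoint xs ys
unique-++⇒disjoint (x ∷ xs) (x≢ ∷ _) (here refl , x∈ys) = All.lookup x≢ (∈-++⁺ʳ xs x∈ys) refl
unique-++⇒disjoint (x ∷ xs) (_ ∷ !xs) (there v∈xs , v∈ys) = unique-++⇒disjoint xs !xs (v∈xs , v∈ys)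

unique-concat⇒disjoint : ∀ {xss : List (List A)} → Unique (concat xss) →
  xs ∈ xss → ys ∈ xss → x ∈ xs → x ∈ ys → xs ≡ ys
unique-concat⇒disjoint {xss = _ ∷ _}   _ (here refl) (here refl) _ _ = refl
unique-concat⇒disjoint {xss = xs ∷ _} ! (here refl) (there ys∈) x∈xs x∈ys =
  ⊥-elim (unique-++⇒disjoint xs ! (x∈xs , ∈-concat⁺′ x∈ys ys∈))
unique-concat⇒disjoint {xss = ys ∷ _} ! (there xs∈) (here refl) x∈xs x∈ys =
  ⊥-elim (unique-++⇒disjoint ys ! (x∈ys , ∈-concat⁺′ x∈xs xs∈))
unique-concat⇒disjoint {xss = zs ∷ _} ! (there xs∈) (there ys∈) x∈xs x∈ys =
  unique-concat⇒disjoint (AllPairs-resp-⊑ (++⁺ˡ zs ⊆-refl) !) xs∈ ys∈ x∈xs x∈ys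

consecutivePairs : List A → List (A × A)
consecutivePairs (x ∷ y ∷ xs) = (x , y) ∷ consecutivePairs (y ∷ xs)
consecutivePairs _            = []

map-proj₁-consecutivePairs : ∀ (xs : List A) y → map proj₁ (consecutivePairs (xs ++ [ y ])) ≡ xs
map-proj₁-consecutivePairs []           y = refl
map-proj₁-consecutivePairs (x ∷ [])     y = refl
map-proj₁-consecutivePairs (x ∷ x′ ∷ xs) y = cong (x ∷_) (map-proj₁-consecutivePairs (x′ ∷ xs) y)

map-proj₂-consecutivePairs : ∀ (x : A) xs → map proj₂ (consecutivePairs (x ∷ xs)) ≡ xs
map-proj₂-consecutivePairs x []       = refl
map-proj₂-consecutivePairs x (y ∷ xs) = cong (y ∷_) (map-proj₂-consecutivePairs y xs)

consecutivePairs-∷⁺ : consecutivePairs xs ⊆ consecutivePairs (x ∷ xs)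
consecutivePairs-∷⁺ {xs = _ ∷ _ ∷ _} p∈ = there p∈

consecutivePairs-++⁺ʳ : ∀ (us : List A) → consecutivePairs xs ⊆ consecutivePairs (us ++ xs)
consecutivePairs-++⁺ʳ []       = λ p∈ → p∈
consecutivePairs-++⁺ʳ (u ∷ us) = consecutivePairs-∷⁺ {x = u} ∘ consecutivePairs-++⁺ʳ us

consecutivePairs-++⁺ˡ : ∀ (xs : List A) → consecutivePairs xs ⊆ consecutivePairs (xs ++ ys)
consecutivePairs-++⁺ˡ (x ∷ x′ ∷ xs) (here refl) = here refl
consecutivePairs-++⁺ˡ (x ∷ x′ ∷ xs) (there p∈) = there (consecutivePairs-++⁺ˡ (x′ ∷ xs) p∈)

∈-consecutivePairs-∷ʳ⁻ : ∀ (xs : List A) {a b y} → (a , b) ∈ consecutivePairs (xs ++ [ y ]) →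
  (a , b) ∈ consecutivePairs xs ⊎ (b ≡ y × ∃[ us ] xs ≡ us ++ [ a ])
∈-consecutivePairs-∷ʳ⁻ (x ∷ [])      (here refl) = inj₂ (refl , [] , refl)
∈-consecutivePairs-∷ʳ⁻ (x ∷ x′ ∷ xs) (here refl) = inj₁ (here refl)
∈-consecutivePairs-∷ʳ⁻ (x ∷ x′ ∷ xs) (there p∈) with ∈-consecutivePairs-∷ʳ⁻ (x′ ∷ xs) p∈
... | inj₁ p∈′              = inj₁ (there p∈′)
... | inj₂ (b≡y , us , eq) = inj₂ (b≡y , x ∷ us , cong (x ∷_) eq)

consecutivePairs-⊑ : ∀ {a b : A} xs → (a , b) ∈ consecutivePairs xs → a ∷ b ∷ [] ⊑ xs
consecutivePairs-⊑ (x ∷ x′ ∷ xs) (here refl) = refl ∷ refl ∷ minimum xs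
consecutivePairs-⊑ (x ∷ x′ ∷ xs) (there p∈) = x ∷ʳ consecutivePairs-⊑ (x′ ∷ xs) p∈

AllPairs⇒consecutive : ∀ {R : A → A → Set} {a b} → AllPairs R xs →
  (a , b) ∈ consecutivePairs xs → R a b
AllPairs⇒consecutive ((Rxx′ ∷ _) ∷ _) (here refl) = Rxx′
AllPairs⇒consecutive (_ ∷ rs@(_ ∷ _)) (there p∈) = AllPairs⇒consecutive rs p∈

decreasing⊎ascent : ∀ xs → AllPairs _>_ xs ⊎ ∃₂ λ a b → (a , b) ∈ consecutivePairs xs × a ≤ b
decreasing⊎ascent []           = inj₁ []
decreasing⊎ascent (x ∷ [])     = inj₁ ([] ∷ [])
decreasing⊎ascent (x ∷ y ∷ xs) with y <? x | decreasing⊎ascent (y ∷ xs)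
... | no  y≮x | _                         = inj₂ (x , y , here refl , ℕ.≮⇒≥ y≮x)
... | yes _   | inj₂ (a , b , p∈ , a≤b)    = inj₂ (a , b , there p∈ , a≤b)
... | yes y<x | inj₁ (y> ∷ dec)           = inj₁ ((y<x ∷ All.map (flip ℕ.<-trans y<x) y>) ∷ y> ∷ dec)

≡ᴸ⇒≡ : ∀ xs ys → T (xs ≡ᴸ ys) → xs ≡ ys
≡ᴸ⇒≡ [] [] _ = refl
≡ᴸ⇒≡ (x ∷ xs) (y ∷ ys) t with to T-∧ t
... | x≡y , xs≡ys = cong₂ _∷_ (ℕ.≡ᵇ⇒≡ x y x≡y) (≡ᴸ⇒≡ xs ys xs≡ys)

≡⇒≡ᴸ : ∀ xs → T (xs ≡ᴸ xs)
≡⇒≡ᴸ [] = _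
≡⇒≡ᴸ (x ∷ xs) = from T-∧ (ℕ.≡⇒≡ᵇ x x refl , ≡⇒≡ᴸ xs)

elemᵇ⇒∈ : ∀ {x} xs → T (elemᵇ x xs) → x ∈ xs
elemᵇ⇒∈ {x} xs t = Any.map (ℕ.≡ᵇ⇒≡ x _) (any⁻ (x ≡ᵇ_) xs t)

∈⇒elemᵇ : ∀ {x} {xs : List ℕ} → x ∈ xs → T (elemᵇ x xs)
∈⇒elemᵇ {x} x∈ = any⁺ (x ≡ᵇ_) (Any.map (ℕ.≡⇒≡ᵇ x _) x∈)

T-not⇔¬T : ∀ {b} → T (not b) ⇔ (¬ T b)
T-not⇔¬T {false} = mk⇔ (λ _ ()) (λ _ → _)
T-not⇔¬T {true}  = mk⇔ (λ ()) (λ ¬t → ¬t _)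

subsequence⇔ : ∀ {w π : List ℕ} → T (any (λ s → s ≡ᴸ w) (sublists π)) ⇔ w ⊑ π
subsequence⇔ {w} {π} = mk⇔ ⇒ (λ w⊑π → any⁺ _ (lose (∈-sublists⁺ w⊑π) (≡⇒≡ᴸ w)))
  where
  ⇒ : T (any (λ s → s ≡ᴸ w) (sublists π)) → w ⊑ π
  ⇒ t with find (any⁻ _ (sublists π) t)
  ... | s , s∈ , s≡w with ≡ᴸ⇒≡ s w s≡w
  ... | refl = ∈-sublists⁻ π s∈

range-increasing : ∀ n → AllPairs _<_ (range n)
range-increasing n = AllPairs.applyUpTo⁺₁ suc n (λ i<j _ → s≤s i<j)

range-unique : ∀ n → Unique (range n)
range-unique n = AllPairs.map ℕ.<⇒≢ (range-increasing n)

at-map-applyUpTo : ∀ (f g : ℕ → ℕ) {n i} → i < n → at (map f (applyUpTo g n)) (suc i) ≡ f (g i)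
at-map-applyUpTo f g {suc n} {zero} _ = refl
at-map-applyUpTo f g {suc n} {suc i} (s≤s i<n) = at-map-applyUpTo f (g ∘ suc) i<n

at-map-range : ∀ (f : ℕ → ℕ) {n x} → x ∈ range n → at (map f (range n)) x ≡ f x
at-map-range f x∈ with ∈-applyUpTo⁻ suc x∈
... | _ , i<n , refl = at-map-applyUpTo f suc i<n

concatMap-map≡cartesianProductWith : ∀ {C : Set} (f : A → B → C) xs ys →
  concatMap (λ x → map (f x) ys) xs ≡ cartesianProductWith f xs ys
concatMap-map≡cartesianProductWith f [] ys = refl
concatMap-map≡cartesianProductWith f (x ∷ xs) ys =
  cong (map (f x) ys ++_) (concatMap-map≡cartesianProductWith f xs ys)

words-suc : ∀ as n → words as (suc n) ≡ cartesianProductWith _∷_ as (words as n)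
words-suc as n = concatMap-map≡cartesianProductWith _∷_ as (words as n)

∈-words⁺ : ∀ as {w} → All (_∈ as) w → w ∈ words as (length w)
∈-words⁺ as [] = here refl
∈-words⁺ as {a ∷ w} (a∈ ∷ w⊆) =
  subst (a ∷ w ∈_) (sym (words-suc as (length w))) (∈-cartesianProductWith⁺ _∷_ a∈ (∈-words⁺ as w⊆))

∈-words⁻ : ∀ as n {w} → w ∈ words as n → length w ≡ n × All (_∈ as) w
∈-words⁻ as zero (here refl) = refl , []
∈-words⁻ as (suc n) w∈
  with ∈-cartesianProductWith⁻ _∷_ as (words as n) (subst (_ ∈_) (words-suc as n) w∈)
... | a , v , a∈ , v∈ , refl with ∈-words⁻ as n v∈
...   | refl , v⊆ = refl , a∈ ∷ v⊆

words-unique : ∀ {as} n → Unique as → Unique (words as n)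
words-unique zero _ = [] ∷ []
words-unique {as} (suc n) !as = subst Unique (sym (words-suc as n))
  (Unique.cartesianProductWith⁺ _∷_ ∷-injective !as (words-unique n !as))

record IsPermutation (n : ℕ) (π : List ℕ) : Set where
  field
    unique : Unique π
    ⊆range : π ⊆ range n
    range⊆ : range n ⊆ π

  length≡ : length π ≡ n
  length≡ = trans
    (ℕ.≤-antisym (unique⊆⇒length≤ unique ⊆range) (unique⊆⇒length≤ (range-unique n) range⊆))
    (length-applyUpTo suc n)

∈-perms⁻ : ∀ {n π} → π ∈ perms n → IsPermutation n π
∈-perms⁻ {n} {π} π∈ with ∈-filter⁻ (T? ∘ isPerm n) π∈
... | π∈words , isPermπ with to T-∧ isPermπ | ∈-words⁻ (range n) n π∈words
...   | length≡n , covers | _ , π⊆range = record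
  { unique = unique⊆∧length≤⇒unique ℕ._≟_ (range-unique n) range⊆π
      (ℕ.≤-reflexive (trans (ℕ.≡ᵇ⇒≡ _ n length≡n) (sym (length-applyUpTo suc n))))
  ; ⊆range = All.lookup π⊆range
  ; range⊆ = range⊆π
  }
  where
  range⊆π : range n ⊆ π
  range⊆π = elemᵇ⇒∈ π ∘ All.lookup (all⁺ (λ i → elemᵇ i π) (range n) covers)

∈-perms⁺ : ∀ {n π} → IsPermutation n π → π ∈ perms n
∈-perms⁺ {n} {π} isPermutation = ∈-filter⁺ (T? ∘ isPerm n)
  (subst (λ k → π ∈ words (range n) k) length≡ (∈-words⁺ (range n) (All.tabulate ⊆range)))
  (from T-∧ (ℕ.≡⇒≡ᵇ _ n length≡ , all⁻ (λ i → elemᵇ i π) (All.tabulate (∈⇒elemᵇ ∘ range⊆))))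
  where open IsPermutation isPermutation

perms-unique : ∀ n → Unique (perms n)
perms-unique n = Unique.filter⁺ (T? ∘ isPerm n) (words-unique n (range-unique n))

subsetsOfSize : ℕ → ℕ → List (List ℕ)
subsetsOfSize n k = filterᵇ (λ X → length X ≡ᵇ k) (sublists (range n))

∈-subsetsOfSize⁺ : ∀ {n k X} → X ⊑ range n → length X ≡ k → X ∈ subsetsOfSize n k
∈-subsetsOfSize⁺ {n} {k} X⊑ refl =
  ∈-filter⁺ (T? ∘ λ X → length X ≡ᵇ k) (∈-sublists⁺ X⊑) (ℕ.≡⇒≡ᵇ _ k refl)

∈-subsetsOfSize⁻ : ∀ {n k X} → X ∈ subsetsOfSize n k → X ⊑ range n × length X ≡ k
∈-subsetsOfSize⁻ {n} {k} {X} X∈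
  with ∈-filter⁻ (T? ∘ λ X → length X ≡ᵇ k) {xs = sublists (range n)} X∈
... | X∈sublists , size = ∈-sublists⁻ (range n) X∈sublists , ℕ.≡ᵇ⇒≡ (length X) k size

-- Segments at left-to-right maxima

data IsSegment : List ℕ → Set where
  segment : ∀ {h t} → All (_< h) t → IsSegment (h ∷ t)

hd : List ℕ → ℕ
hd [] = 0
hd (x ∷ _) = x

segmentsFrom : ℕ → List ℕ → List ℕ → List (List ℕ)
segmentsFrom h cur [] = (h ∷ cur) ∷ []
segmentsFrom h cur (y ∷ ys) with y <? h
... | yes _ = segmentsFrom h (cur ++ [ y ]) ys
... | no  _ = (h ∷ cur) ∷ segmentsFrom y [] ys

segments : List ℕ → List (List ℕ)
segments [] = []
segments (x ∷ xs) = segmentsFrom x [] xs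

concat-segmentsFrom : ∀ h cur ys → concat (segmentsFrom h cur ys) ≡ h ∷ cur ++ ys
concat-segmentsFrom h cur [] = refl
concat-segmentsFrom h cur (y ∷ ys) with y <? h
... | yes _ = trans (concat-segmentsFrom h (cur ++ [ y ]) ys) (cong (h ∷_) (++-assoc cur [ y ] ys))
... | no  _ = cong ((h ∷ cur) ++_) (concat-segmentsFrom y [] ys)

concat-segments : ∀ π → concat (segments π) ≡ π
concat-segments [] = refl
concat-segments (x ∷ xs) = concat-segmentsFrom x [] xs

segmentsFrom-segments : ∀ h {cur} ys → All (_< h) cur → All IsSegment (segmentsFrom h cur ys)
segmentsFrom-segments h [] cur<h = segment cur<h ∷ []
segmentsFrom-segments h (y ∷ ys) cur<h with y <? h
... | yes y<h = segmentsFrom-segments h ys (All-++⁺ cur<h (y<h ∷ []))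
... | no  _   = segment cur<h ∷ segmentsFrom-segments y ys []

segments-segments : ∀ π → All IsSegment (segments π)
segments-segments [] = []
segments-segments (x ∷ xs) = segmentsFrom-segments x xs []

segmentsFrom-heads≥ : ∀ h cur ys → All ((h ≤_) ∘ hd) (segmentsFrom h cur ys)
segmentsFrom-heads≥ h cur [] = ℕ.≤-refl ∷ []
segmentsFrom-heads≥ h cur (y ∷ ys) with y <? h
... | yes _   = segmentsFrom-heads≥ h (cur ++ [ y ]) ys
... | no  y≮h = ℕ.≤-refl ∷ All.map (ℕ.≤-trans (ℕ.≮⇒≥ y≮h)) (segmentsFrom-heads≥ y [] ys)

segmentsFrom-increasing : ∀ h cur ys → Unique (h ∷ cur ++ ys) →
  AllPairs (_<_ on hd) (segmentsFrom h cur ys)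
segmentsFrom-increasing h cur [] _ = [] ∷ []
segmentsFrom-increasing h cur (y ∷ ys) !π with y <? h
... | yes _ = segmentsFrom-increasing h (cur ++ [ y ]) ys
                (subst (Unique ∘ (h ∷_)) (sym (++-assoc cur [ y ] ys)) !π)
... | no y≮h = All.map (ℕ.<-≤-trans h<y) (segmentsFrom-heads≥ y [] ys)
             ∷ segmentsFrom-increasing y [] ys (AllPairs-resp-⊑ (++⁺ˡ (h ∷ cur) ⊆-refl) !π)
  where
  h<y : h < y
  h<y = ℕ.≤∧≢⇒< (ℕ.≮⇒≥ y≮h) (All.lookup (AllPairs.head !π) (∈-++⁺ʳ cur (here refl)))

segments-increasing : ∀ {π} → Unique π → AllPairs (_<_ on hd) (segments π)
segments-increasing {[]} _ = []
segments-increasing {x ∷ xs} !π = segmentsFrom-increasing x [] xs !π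

segmentsFrom-concat : ∀ h cur t {bs} → All (_< h) t → All IsSegment bs → AllPairs (_<_ on hd) bs →
  All ((h <_) ∘ hd) bs → segmentsFrom h cur (t ++ concat bs) ≡ (h ∷ cur ++ t) ∷ bs
segmentsFrom-concat h cur (z ∷ t) {bs} (z<h ∷ t<h) segs sorted h< with z <? h
... | yes _   = trans (segmentsFrom-concat h (cur ++ [ z ]) t t<h segs sorted h<)
                      (cong (λ c → (h ∷ c) ∷ bs) (++-assoc cur [ z ] t))
... | no  z≮h = contradiction z<h z≮h
segmentsFrom-concat h cur [] [] [] [] [] = cong (λ c → (h ∷ c) ∷ []) (sym (++-identityʳ cur))
segmentsFrom-concat h cur [] [] (segment {h′} {t′} t′<h′ ∷ segs) (h′< ∷ sorted) (h<h′ ∷ _)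
  with h′ <? h
... | yes h′<h = contradiction h′<h (ℕ.<-asym h<h′)
... | no  _    = cong₂ (λ c bs → (h ∷ c) ∷ bs) (sym (++-identityʳ cur))
                       (segmentsFrom-concat h′ [] t′ t′<h′ segs sorted h′<)

segments-concat : ∀ {bs} → All IsSegment bs → AllPairs (_<_ on hd) bs → segments (concat bs) ≡ bs
segments-concat [] [] = refl
segments-concat (segment {h} {t} t<h ∷ segs) (h< ∷ sorted) =
  segmentsFrom-concat h [] t t<h segs sorted h<

∈-segments : ∀ {π x} → x ∈ π → ∃[ s ] s ∈ segments π × x ∈ s
∈-segments {π} x∈ = find (∈-concat⁻ (segments π) (subst (_ ∈_) (sym (concat-segments π)) x∈))

segment-⊑ : ∀ {π s} → s ∈ segments π → s ⊑ π
segment-⊑ {π} s∈ = subst (_ ⊑_) (concat-segments π) (All.lookup (all⊆concat (segments π)) s∈)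

decreasing⇒segment : ∀ {s} → AllPairs _>_ s → 1 ≤ length s → IsSegment s
decreasing⇒segment (s> ∷ _) _ = segment s>

-- The inverse of the fundamental bijection

cycleArcs : List ℕ → List (ℕ × ℕ)
cycleArcs []      = []
cycleArcs (h ∷ t) = consecutivePairs (h ∷ t ++ [ h ])

arcs : List ℕ → List (ℕ × ℕ)
arcs π = concatMap cycleArcs (segments π)

lookupArc : ℕ → List (ℕ × ℕ) → ℕ
lookupArc x [] = 0
lookupArc x ((a , b) ∷ ps) with x ℕ.≟ a
... | yes _ = b
... | no  _ = lookupArc x ps

-- θ⁻¹ n π is π̂ in one-line notation; successor π x is junk (0) unless x ∈ π.
successor : List ℕ → ℕ → ℕ
successor π x = lookupArc x (arcs π)

θ⁻¹ : ℕ → List ℕ → List ℕ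
θ⁻¹ n π = map (successor π) (range n)

map-proj₁-cycleArcs : ∀ s → map proj₁ (cycleArcs s) ≡ s
map-proj₁-cycleArcs []      = refl
map-proj₁-cycleArcs (h ∷ t) = map-proj₁-consecutivePairs (h ∷ t) h

map-proj₂-cycleArcs : ∀ h t → map proj₂ (cycleArcs (h ∷ t)) ≡ t ++ [ h ]
map-proj₂-cycleArcs h t = map-proj₂-consecutivePairs h (t ++ [ h ])

cycleArcs-target-∈ : ∀ s {p} → p ∈ cycleArcs s → proj₂ p ∈ s
cycleArcs-target-∈ (h ∷ t) p∈ =
  ∈-rotate⁻ t (subst (_ ∈_) (map-proj₂-cycleArcs h t) (∈-map⁺ proj₂ p∈))

∈-cycleArcs-target : ∀ s {y} → y ∈ s → ∃[ x ] (x , y) ∈ cycleArcs s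
∈-cycleArcs-target (h ∷ t) y∈
  with ∈-map⁻ proj₂ (subst (_ ∈_) (sym (map-proj₂-cycleArcs h t)) (∈-rotate⁺ t y∈))
... | (x , _) , p∈ , refl = x , p∈

map-proj₁-arcs : ∀ π → map proj₁ (arcs π) ≡ π
map-proj₁-arcs π = begin
  map proj₁ (concatMap cycleArcs (segments π))    ≡⟨ map-concatMap proj₁ cycleArcs (segments π) ⟩
  concatMap (map proj₁ ∘ cycleArcs) (segments π)  ≡⟨ concatMap-cong map-proj₁-cycleArcs (segments π) ⟩
  concat (map (λ s → s) (segments π))             ≡⟨ cong concat (map-id (segments π)) ⟩
  concat (segments π)                             ≡⟨ concat-segments π ⟩
  π                                               ∎
  where open ≡-Reasoning

lookupArc-∈ : ∀ {a} ps → a ∈ map proj₁ ps → (a , lookupArc a ps) ∈ ps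
lookupArc-∈ {a} ((c , d) ∷ ps) a∈ with a ℕ.≟ c
... | yes refl = here refl
... | no  a≢c  = there (lookupArc-∈ ps (Any.tail a≢c a∈))

lookupArc-unique : ∀ {a b} ps → Unique (map proj₁ ps) → (a , b) ∈ ps → lookupArc a ps ≡ b
lookupArc-unique {a} ((c , d) ∷ ps) (c≢ ∷ !ps) p∈ with a ℕ.≟ c | p∈
... | yes refl | here refl  = refl
... | yes refl | there p∈′ = contradiction refl (All.lookup c≢ (∈-map⁺ proj₁ p∈′))
... | no  a≢c  | here refl  = contradiction refl a≢c
... | no  _    | there p∈′ = lookupArc-unique ps !ps p∈′

∈-arcs⁺ : ∀ {π s p} → s ∈ segments π → p ∈ cycleArcs s → p ∈ arcs π
∈-arcs⁺ s∈ p∈ = ∈-concatMap⁺ cycleArcs (Any.map (λ { refl → p∈ }) s∈)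

∈-arcs⁻ : ∀ {π p} → p ∈ arcs π → ∃[ s ] s ∈ segments π × p ∈ cycleArcs s
∈-arcs⁻ p∈ = find (∈-concatMap⁻ cycleArcs p∈)

successor-arc : ∀ {π a b} → Unique π → (a , b) ∈ arcs π → successor π a ≡ b
successor-arc {π} !π = lookupArc-unique (arcs π) (subst Unique (sym (map-proj₁-arcs π)) !π)

arc-successor : ∀ {π a} → a ∈ π → (a , successor π a) ∈ arcs π
arc-successor {π} a∈ = lookupArc-∈ (arcs π) (subst (_ ∈_) (sym (map-proj₁-arcs π)) a∈)

IsPath : (ℕ → ℕ) → List ℕ → Set
IsPath f w = All (λ p → f (proj₁ p) ≡ proj₂ p) (consecutivePairs w)

IsPath-++⁻ʳ : ∀ {f} us {w} → IsPath f (us ++ w) → IsPath f w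
IsPath-++⁻ʳ us = anti-mono (consecutivePairs-++⁺ʳ us)

IsPath-∷⁻ : ∀ {f} x w {y} → IsPath f (x ∷ w ++ [ y ]) →
  f x ≡ hd (w ++ [ y ]) × IsPath f (w ++ [ y ])
IsPath-∷⁻ x []      (fx≡y ∷ path) = fx≡y , path
IsPath-∷⁻ x (_ ∷ _) (fx≡y ∷ path) = fx≡y , path

orbitFrom-step : ∀ {fuel} σ m c → c ≢ m →
  orbitFrom (suc fuel) σ m c ≡ c ∷ orbitFrom fuel σ m (at σ c)
orbitFrom-step σ m c c≢m rewrite dec-false (c ℕ.≟ m) c≢m = refl

orbitFrom-self : ∀ fuel σ m → orbitFrom fuel σ m m ≡ []
orbitFrom-self zero    σ m = refl
orbitFrom-self (suc _) σ m rewrite dec-true (m ℕ.≟ m) refl = refl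

orbitFrom-⊇-path : ∀ {σ m} fuel w → IsPath (at σ) w → All (_≢ m) w → length w ≤ fuel →
  w ⊆ orbitFrom fuel σ m (hd w)
orbitFrom-⊇-path {σ} {m} (suc f) (c ∷ []) _ (c≢m ∷ _) _ (here refl)
  rewrite orbitFrom-step {f} σ m c c≢m = here refl
orbitFrom-⊇-path {σ} {m} (suc f) (c ∷ d ∷ w) (σc≡d ∷ path) (c≢m ∷ w≢m) (s≤s len) z∈
  rewrite orbitFrom-step {f} σ m c c≢m | σc≡d with z∈
... | here refl = here refl
... | there z∈w = there (orbitFrom-⊇-path f (d ∷ w) path w≢m len z∈w)

orbitFrom-path-to : ∀ {σ m} fuel w → IsPath (at σ) (w ++ [ m ]) → All (_≢ m) w → length w ≤ fuel →
  orbitFrom fuel σ m (hd (w ++ [ m ])) ≡ w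
orbitFrom-path-to {σ} {m} fuel [] _ _ _ = orbitFrom-self fuel σ m
orbitFrom-path-to {σ} {m} (suc f) (c ∷ []) (σc≡m ∷ _) (c≢m ∷ _) _
  rewrite orbitFrom-step {f} σ m c c≢m | σc≡m | orbitFrom-self f σ m = refl
orbitFrom-path-to {σ} {m} (suc f) (c ∷ d ∷ w) (σc≡d ∷ path) (c≢m ∷ w≢m) (s≤s len)
  rewrite orbitFrom-step {f} σ m c c≢m | σc≡d = cong (c ∷_) (orbitFrom-path-to f (d ∷ w) path w≢m len)

module Inverse {n π} (perm : IsPermutation n π) where

  open IsPermutation perm

  σ : List ℕ
  σ = θ⁻¹ n π

  length-σ : length σ ≡ n
  length-σ = trans (length-map (successor π) (range n)) (length-applyUpTo suc n)

  arc-source-∈ : ∀ {p} → p ∈ arcs π → proj₁ p ∈ π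
  arc-source-∈ p∈ = subst (_ ∈_) (map-proj₁-arcs π) (∈-map⁺ proj₁ p∈)

  at-σ : ∀ {x} → x ∈ π → at σ x ≡ successor π x
  at-σ x∈ = at-map-range (successor π) (⊆range x∈)

  at-σ-arc : ∀ {p} → p ∈ arcs π → at σ (proj₁ p) ≡ proj₂ p
  at-σ-arc p∈ = trans (at-σ (arc-source-∈ p∈)) (successor-arc unique p∈)

  segment-path : ∀ {h t} → h ∷ t ∈ segments π → IsPath (at σ) (h ∷ t ++ [ h ])
  segment-path s∈ = All.tabulate (at-σ-arc ∘ ∈-arcs⁺ {π} s∈)

  segment-length : ∀ {s} → s ∈ segments π → length s ≤ n
  segment-length s∈ = subst (_ ≤_) length≡ (length-mono-≤ (segment-⊑ {π} s∈))

  cycleOf-head : ∀ {h t} → h ∷ t ∈ segments π → cycleOf σ h ≡ h ∷ t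
  cycleOf-head {h} {t} s∈ with All.lookup (segments-segments π) s∈ | IsPath-∷⁻ h t (segment-path s∈)
  ... | segment t<h | σh≡ , path rewrite length-σ | σh≡ =
    cong (h ∷_) (orbitFrom-path-to n t path (All.map ℕ.<⇒≢ t<h) (ℕ.<⇒≤ (segment-length s∈)))

  path-after : ∀ {h pre x post} → h ∷ pre ++ x ∷ post ∈ segments π →
    at σ x ≡ hd (post ++ [ h ]) × IsPath (at σ) (post ++ [ h ])
  path-after {h} {pre} {x} {post} s∈ = IsPath-∷⁻ x post (IsPath-++⁻ʳ (h ∷ pre)
    (subst (IsPath (at σ) ∘ (h ∷_)) (++-assoc pre (x ∷ post) [ h ]) (segment-path s∈)))

  head∈cycleOf : ∀ {h t x} → h ∷ t ∈ segments π → x ∈ t → h ∈ cycleOf σ x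
  head∈cycleOf {h} {t} {x} s∈ x∈t with All.lookup (segments-segments π) s∈ | ∈-∃++ x∈t
  ... | segment t<h | pre , post , refl with path-after s∈
  ... | σx≡ , path rewrite length-σ | σx≡ =
    there (orbitFrom-⊇-path n (post ++ [ h ]) path avoids-x length-≤ (∈-++⁺ʳ post (here refl)))
    where
    x∷post⊑π : x ∷ post ⊑ π
    x∷post⊑π = ⊆-trans (h ∷ʳ ++⁺ˡ pre ⊆-refl) (segment-⊑ {π} s∈)
    avoids-x : All (_≢ x) (post ++ [ h ])
    avoids-x = All-++⁺ (All.map ≢-sym (AllPairs.head (AllPairs-resp-⊑ x∷post⊑π unique)))
                       (ℕ.>⇒≢ (All.lookup t<h (∈-++⁺ʳ pre (here refl))) ∷ [])
    length-≤ : length (post ++ [ h ]) ≤ n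
    length-≤ = begin
      length (post ++ [ h ])  ≡⟨ length-++ post ⟩
      length post + 1         ≡⟨ ℕ.+-comm (length post) 1 ⟩
      length (x ∷ post)       ≤⟨ length-mono-≤ x∷post⊑π ⟩
      length π                ≡⟨ length≡ ⟩
      n                       ∎
      where open ℕ.≤-Reasoning

  isCycleMax-head : ∀ {h t} → h ∷ t ∈ segments π → T (isCycleMax σ h)
  isCycleMax-head {h} {t} s∈ with All.lookup (segments-segments π) s∈
  ... | segment t<h = subst (T ∘ all (_≤ᵇ h)) (sym (cycleOf-head s∈))
    (all⁻ (_≤ᵇ h) {h ∷ t} (ℕ.≤⇒≤ᵇ (ℕ.≤-refl {h}) ∷ All.map (ℕ.≤⇒≤ᵇ ∘ ℕ.<⇒≤) t<h))

  ¬isCycleMax-tail : ∀ {h t x} → h ∷ t ∈ segments π → x ∈ t → ¬ T (isCycleMax σ x)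
  ¬isCycleMax-tail {h} {x = x} s∈ x∈t max with All.lookup (segments-segments π) s∈
  ... | segment t<h = ℕ.<⇒≱ (All.lookup t<h x∈t)
    (ℕ.≤ᵇ⇒≤ h x (All.lookup (all⁺ (_≤ᵇ x) (cycleOf σ x) max) (head∈cycleOf s∈ x∈t)))

  cycleMaxima≡heads : filterᵇ (isCycleMax σ) (range n) ≡ map hd (segments π)
  cycleMaxima≡heads = ⊆-antisym-AllPairs ℕ.<-asym
    (AllPairs.filter⁺ (T? ∘ isCycleMax σ) (range-increasing n))
    (AllPairs.map⁺ (segments-increasing unique))
    maxima⊆heads heads⊆maxima
    where
    maxima⊆heads : filterᵇ (isCycleMax σ) (range n) ⊆ map hd (segments π)
    maxima⊆heads m∈ with ∈-filter⁻ (T? ∘ isCycleMax σ) m∈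
    ... | m∈range , max with ∈-segments (range⊆ m∈range)
    ... | _ ∷ _ , s∈ , here refl = ∈-map⁺ hd s∈
    ... | _ ∷ _ , s∈ , there m∈t = contradiction max (¬isCycleMax-tail s∈ m∈t)
    heads⊆maxima : map hd (segments π) ⊆ filterᵇ (isCycleMax σ) (range n)
    heads⊆maxima h∈ with ∈-map⁻ hd h∈
    ... | s , s∈ , refl with All.lookup (segments-segments π) s∈
    ...   | segment _ = ∈-filter⁺ (T? ∘ isCycleMax σ)
                          (⊆range (Any-resp-⊆ (segment-⊑ {π} s∈) (here refl))) (isCycleMax-head s∈)

  cycles≡segments : map (cycleOf σ) (map hd (segments π)) ≡ segments π
  cycles≡segments = trans (sym (map-∘ (segments π))) (map-id-local (All.tabulate cycleOf-hd))
    where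
    cycleOf-hd : ∀ {s} → s ∈ segments π → cycleOf σ (hd s) ≡ s
    cycleOf-hd s∈ with All.lookup (segments-segments π) s∈
    ... | segment _ = cycleOf-head s∈

  θ-θ⁻¹ : θ σ ≡ π
  θ-θ⁻¹ = begin
    concat (map (cycleOf σ) (filterᵇ (isCycleMax σ) (range (length σ))))
      ≡⟨ cong (λ k → concat (map (cycleOf σ) (filterᵇ (isCycleMax σ) (range k)))) length-σ ⟩
    concat (map (cycleOf σ) (filterᵇ (isCycleMax σ) (range n)))
      ≡⟨ cong (concat ∘ map (cycleOf σ)) cycleMaxima≡heads ⟩
    concat (map (cycleOf σ) (map hd (segments π)))
      ≡⟨ cong concat cycles≡segments ⟩
    concat (segments π)
      ≡⟨ concat-segments π ⟩
    π ∎
    where open ≡-Reasoning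

  σ⊆range : σ ⊆ range n
  σ⊆range y∈ with ∈-map⁻ (successor π) y∈
  ... | x , x∈range , refl with ∈-arcs⁻ {π} (arc-successor (range⊆ x∈range))
  ... | s , s∈ , p∈ = ⊆range (Any-resp-⊆ (segment-⊑ {π} s∈) (cycleArcs-target-∈ s p∈))

  range⊆σ : range n ⊆ σ
  range⊆σ i∈ with ∈-segments (range⊆ i∈)
  ... | s , s∈ , i∈s with ∈-cycleArcs-target s i∈s
  ... | x , p∈ = subst (_∈ σ) (successor-arc unique arc∈)
                   (∈-map⁺ (successor π) (⊆range (arc-source-∈ arc∈)))
    where arc∈ = ∈-arcs⁺ {π} s∈ p∈

  θ⁻¹-permutation : IsPermutation n σ
  θ⁻¹-permutation = record
    { unique = unique⊆∧length≤⇒unique ℕ._≟_ (range-unique n) range⊆σ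
                 (ℕ.≤-reflexive (trans length-σ (sym (length-applyUpTo suc n))))
    ; ⊆range = σ⊆range
    ; range⊆ = range⊆σ
    }

module _ {n : ℕ} where

  θ⁻¹-∈-perms : ∀ {π} → π ∈ perms n → θ⁻¹ n π ∈ perms n
  θ⁻¹-∈-perms π∈ = ∈-perms⁺ (Inverse.θ⁻¹-permutation {n} (∈-perms⁻ π∈))

  θ-θ⁻¹ : ∀ {π} → π ∈ perms n → θ (θ⁻¹ n π) ≡ π
  θ-θ⁻¹ π∈ = Inverse.θ-θ⁻¹ {n} (∈-perms⁻ π∈)

  -- θ⁻¹ is injective on S_n (θ is a left inverse), so by counting it is onto S_n.
  perms⊆θ⁻¹-image : perms n ⊆ map (θ⁻¹ n) (perms n)
  perms⊆θ⁻¹-image = unique⊆∧length≤⇒⊇ (≡-dec ℕ._≟_)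
    (map-unique-of-retraction (θ⁻¹ n) θ (perms-unique n) θ-θ⁻¹)
    (λ σ∈ → case ∈-map⁻ (θ⁻¹ n) σ∈ of λ { (_ , π∈ , refl) → θ⁻¹-∈-perms π∈ })
    (ℕ.≤-reflexive (sym (length-map (θ⁻¹ n) (perms n))))

  θ⁻¹-θ : ∀ {σ} → σ ∈ perms n → θ⁻¹ n (θ σ) ≡ σ
  θ⁻¹-θ σ∈ with ∈-map⁻ (θ⁻¹ n) (perms⊆θ⁻¹-image σ∈)
  ... | π , π∈ , refl = cong (θ⁻¹ n) (θ-θ⁻¹ π∈)

  hatSatisfies⇔ : ∀ {π b c} → π ∈ perms n → b ∈ range n →
    T (hatSatisfies n π ((b , c) ∷ [])) ⇔ successor π b ≡ c
  hatSatisfies⇔ {π} {b} {c} π∈ b∈ = mk⇔ ⇒ ⇐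
    where
    ⇒ : T (hatSatisfies n π ((b , c) ∷ [])) → successor π b ≡ c
    ⇒ t with find (any⁻ _ (perms n) t)
    ... | σ , σ∈ , θσ≡π∧σb≡c with to T-∧ θσ≡π∧σb≡c
    ... | θσ≡π , σb≡c = begin
      successor π b      ≡⟨ at-map-range (successor π) b∈ ⟨
      at (θ⁻¹ n π) b     ≡⟨ cong (λ π′ → at (θ⁻¹ n π′) b) (≡ᴸ⇒≡ (θ σ) π θσ≡π) ⟨
      at (θ⁻¹ n (θ σ)) b ≡⟨ cong (λ σ′ → at σ′ b) (θ⁻¹-θ σ∈) ⟩
      at σ b             ≡⟨ ℕ.≡ᵇ⇒≡ _ c (proj₁ (to T-∧ σb≡c)) ⟩
      c                  ∎
      where open ≡-Reasoning
    ⇐ : successor π b ≡ c → T (hatSatisfies n π ((b , c) ∷ []))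
    ⇐ σb≡c = any⁺ _ (Any.map (λ { refl → witness }) (θ⁻¹-∈-perms π∈))
      where
      witness = from T-∧ ( subst (λ π′ → T (π′ ≡ᴸ π)) (sym (θ-θ⁻¹ π∈)) (≡⇒≡ᴸ π)
                         , from T-∧ (ℕ.≡⇒≡ᵇ _ c (trans (at-map-range (successor π) b∈) σb≡c) , _))

-- Avoiders

avoidsBothᵇ : ℕ → List ℕ → Bool
avoidsBothᵇ n π = avoids n pat12 π ∧ avoids n pat1 π

Pattern1 : List ℕ → Set
Pattern1 π = ∃[ a ] a ∈ π × successor π a ≡ a

Pattern12 : List ℕ → Set
Pattern12 π = ∃₂ λ a b → a < b × a ∷ b ∷ [] ⊑ π × successor π a ≡ b

GoodSegment : List ℕ → Set
GoodSegment s = 2 ≤ length s × AllPairs _>_ s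

Good : List ℕ → Set
Good π = All GoodSegment (segments π)

goodSegment-arc : ∀ {h t a b} → GoodSegment (h ∷ t) → (a , b) ∈ cycleArcs (h ∷ t) →
  b < a ⊎ (b ≡ h × a ∈ t)
goodSegment-arc {h} {t} (len , dec) p∈ with ∈-consecutivePairs-∷ʳ⁻ (h ∷ t) p∈
... | inj₁ p∈′             = inj₁ (AllPairs⇒consecutive dec p∈′)
... | inj₂ (refl , us , eq) = inj₂ (refl , last∈tail us len eq)
  where
  last∈tail : ∀ {h a : ℕ} {t} us → 2 ≤ length (h ∷ t) → h ∷ t ≡ us ++ [ a ] → a ∈ t
  last∈tail []       (s≤s ()) refl
  last∈tail (_ ∷ us) _        refl = ∈-++⁺ʳ us (here refl)

module _ {n : ℕ} {π : List ℕ} (π∈ : π ∈ perms n) where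

  open IsPermutation (∈-perms⁻ {n} π∈)

  contains-pat1⇔ : T (contains n pat1 π) ⇔ Pattern1 π
  contains-pat1⇔ = mk⇔ ⇒ ⇐
    where
    ⇒ : T (contains n pat1 π) → Pattern1 π
    ⇒ t with find (any⁻ _ (subsetsOfSize n 1) t)
    ... | X , X∈ , occurs with length≡1⇒ X (proj₂ (∈-subsetsOfSize⁻ {n} X∈))
    ... | a , refl with to T-∧ occurs
    ... | [a]⊑π , hat = a , a∈π , to (hatSatisfies⇔ {n} π∈ (⊆range a∈π)) hat
      where a∈π = to∈ (to subsequence⇔ [a]⊑π)
    ⇐ : Pattern1 π → T (contains n pat1 π)
    ⇐ (a , a∈π , σa≡a) = any⁺ _ (lose X∈ occurs)
      where
      X∈ = ∈-subsetsOfSize⁺ (from∈ (⊆range a∈π)) refl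
      occurs = from T-∧ ( from subsequence⇔ (from∈ a∈π)
                        , from (hatSatisfies⇔ {n} π∈ (⊆range a∈π)) σa≡a)

  contains-pat12⇔ : T (contains n pat12 π) ⇔ Pattern12 π
  contains-pat12⇔ = mk⇔ ⇒ ⇐
    where
    ⇒ : T (contains n pat12 π) → Pattern12 π
    ⇒ t with find (any⁻ _ (subsetsOfSize n 2) t)
    ... | X , X∈ , occurs with length≡2⇒ X (proj₂ (∈-subsetsOfSize⁻ {n} X∈))
    ... | a , b , refl with to T-∧ occurs
    ... | ab⊑π , hat = a , b , a<b , to subsequence⇔ ab⊑π
                     , to (hatSatisfies⇔ {n} π∈ (⊆range (to∈ (to subsequence⇔ ab⊑π)))) hat
      where
      a<b : a < b
      a<b = All.head (AllPairs.head
              (AllPairs-resp-⊑ (proj₁ (∈-subsetsOfSize⁻ {n} X∈)) (range-increasing n)))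
    ⇐ : Pattern12 π → T (contains n pat12 π)
    ⇐ (a , b , a<b , ab⊑π , σa≡b) = any⁺ _ (lose X∈ occurs)
      where
      ab⊆range : a ∷ b ∷ [] ⊆ range n
      ab⊆range = ⊆range ∘ Any-resp-⊆ ab⊑π
      X∈ = ∈-subsetsOfSize⁺
             (increasing-⊆⇒⊑ ((a<b ∷ []) ∷ [] ∷ []) (range-increasing n) ab⊆range) refl
      occurs = from T-∧ ( from subsequence⇔ ab⊑π
                        , from (hatSatisfies⇔ {n} π∈ (ab⊆range (here refl))) σa≡b)

  good⇒¬pattern1 : Good π → ¬ Pattern1 π
  good⇒¬pattern1 good (a , a∈π , σa≡a)
    with ∈-arcs⁻ {π} (subst (λ b → (a , b) ∈ arcs π) σa≡a (arc-successor a∈π))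
  ... | s , s∈ , p∈ with All.lookup (segments-segments π) s∈
  ... | segment t<h with goodSegment-arc (All.lookup good s∈) p∈
  ...   | inj₁ a<a          = ℕ.<-irrefl refl a<a
  ...   | inj₂ (refl , a∈t) = ℕ.<-irrefl refl (All.lookup t<h a∈t)

  good⇒¬pattern12 : Good π → ¬ Pattern12 π
  good⇒¬pattern12 good (a , b , a<b , ab⊑π , σa≡b)
    with ∈-arcs⁻ {π} (subst (λ b → (a , b) ∈ arcs π) σa≡b (arc-successor (to∈ ab⊑π)))
  ... | s , s∈ , p∈ with All.lookup (segments-segments π) s∈
  ... | segment _ with goodSegment-arc (All.lookup good s∈) p∈
  ...   | inj₁ b<a          = ℕ.<-asym a<b b<a
  ...   | inj₂ (refl , a∈t) = ℕ.<-irrefl (pair-⊑-antisym unique ab⊑π ba⊑π) a<b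
    where ba⊑π = ⊆-trans (refl ∷ from∈ a∈t) (segment-⊑ {π} s∈)

  ¬patterns⇒good : ¬ Pattern1 π → ¬ Pattern12 π → Good π
  ¬patterns⇒good ¬pattern1 ¬pattern12 = All.tabulate good
    where
    good : ∀ {s} → s ∈ segments π → GoodSegment s
    good s∈ with All.lookup (segments-segments π) s∈
    ... | segment {h} {[]} _ =
      ⊥-elim (¬pattern1 (h , to∈ (segment-⊑ {π} s∈)
                         , successor-arc unique (∈-arcs⁺ {π} s∈ (here refl))))
    ... | segment {h} {t@(_ ∷ _)} _ with decreasing⊎ascent (h ∷ t)
    ...   | inj₁ dec = s≤s (s≤s z≤n) , dec
    ...   | inj₂ (a , b , p∈ , a≤b) = ⊥-elim (¬pattern12 (a , b , a<b , ab⊑π , σa≡b))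
      where
      ab⊑π = ⊆-trans (consecutivePairs-⊑ (h ∷ t) p∈) (segment-⊑ {π} s∈)
      a<b  = ℕ.≤∧≢⇒< a≤b (All.head (AllPairs.head (AllPairs-resp-⊑ ab⊑π unique)))
      σa≡b = successor-arc unique (∈-arcs⁺ {π} s∈ (consecutivePairs-++⁺ˡ (h ∷ t) p∈))

  avoiders⇔good : T (avoidsBothᵇ n π) ⇔ Good π
  avoiders⇔good = mk⇔ ⇒ ⇐
    where
    ⇒ : T (avoidsBothᵇ n π) → Good π
    ⇒ t with to T-∧ t
    ... | avoids12 , avoids1 = ¬patterns⇒good (to T-not⇔¬T avoids1 ∘ from contains-pat1⇔)
                                               (to T-not⇔¬T avoids12 ∘ from contains-pat12⇔)
    ⇐ : Good π → T (avoidsBothᵇ n π)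
    ⇐ good = from T-∧ ( from T-not⇔¬T (good⇒¬pattern12 good ∘ to contains-pat12⇔)
                      , from T-not⇔¬T (good⇒¬pattern1 good ∘ to contains-pat1⇔))

-- Set partitions without singletons

hd-∈ : ∀ {xs} → 1 ≤ length xs → hd xs ∈ xs
hd-∈ {_ ∷ _} _ = here refl

lastElem : List ℕ → ℕ
lastElem B = hd (reverse B)

lastElem-∈ : ∀ {B} → 1 ≤ length B → lastElem B ∈ B
lastElem-∈ {B} len = reverse⁻ (hd-∈ (subst (1 ≤_) (sym (length-reverse B)) len))

isPartitionᵇ : ℕ → List (List ℕ) → Bool
isPartitionᵇ n F = isSetPartition n F ∧ noSingletonBlock F

record IsPartition (n : ℕ) (F : List (List ℕ)) : Set where
  field
    blocks-⊑   : All (_⊑ range n) F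
    blocks-≥2  : All (λ B → 2 ≤ length B) F
    covering   : ∀ {i} → i ∈ range n → ∃[ B ] B ∈ F × i ∈ B
    disjoint   : ∀ {B B′ i} → B ∈ F → B′ ∈ F → i ∈ B → i ∈ B′ → B ≡ B′

module _ {n : ℕ} {F : List (List ℕ)} (F⊑ : F ⊑ sublists (range n)) where

  partition-unique : Unique F
  partition-unique = AllPairs-resp-⊑ F⊑ (sublists-unique (range-unique n))

  partition⁻ : T (isPartitionᵇ n F) → IsPartition n F
  partition⁻ t with to T-∧ t
  ... | setPartition , noSingleton with to T-∧ setPartition
  ... | _ , counts = record
    { blocks-⊑  = All.tabulate (∈-sublists⁻ (range n) ∘ Any-resp-⊆ F⊑)
    ; blocks-≥2 = All.map (ℕ.≤ᵇ⇒≤ 2 _) (all⁺ (λ B → 2 ≤ᵇ length B) F noSingleton)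
    ; covering  = λ {i} i∈ → case proj₁ (length-filter≡1⇒ (T? ∘ elemᵇ i) (count i∈)) of λ where
                    (B , B∈ , i∈B) → B , B∈ , elemᵇ⇒∈ B i∈B
    ; disjoint  = λ {i = i} B∈ B′∈ i∈B i∈B′ →
                    proj₂ (length-filter≡1⇒ (T? ∘ elemᵇ i) (count (⊑-range B∈ i∈B)))
                      B∈ B′∈ (∈⇒elemᵇ i∈B) (∈⇒elemᵇ i∈B′)
    }
    where
    count : ∀ {i} → i ∈ range n → length (filterᵇ (elemᵇ i) F) ≡ 1
    count {i} i∈ =
      ℕ.≡ᵇ⇒≡ _ 1 (All.lookup (all⁺ (λ i → countᵇ (elemᵇ i) F ≡ᵇ 1) (range n) counts) i∈)
    ⊑-range : ∀ {B i} → B ∈ F → i ∈ B → i ∈ range n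
    ⊑-range B∈ = Any-resp-⊆ (∈-sublists⁻ (range n) (Any-resp-⊆ F⊑ B∈))

  partition⁺ : IsPartition n F → T (isPartitionᵇ n F)
  partition⁺ part = from T-∧
    ( from T-∧ ( all⁻ (λ B → 1 ≤ᵇ length B) (All.map (ℕ.≤⇒≤ᵇ ∘ ℕ.≤-trans (s≤s z≤n)) blocks-≥2)
               , all⁻ (λ i → countᵇ (elemᵇ i) F ≡ᵇ 1) (All.tabulate (ℕ.≡⇒≡ᵇ _ 1 ∘ count)))
    , all⁻ (λ B → 2 ≤ᵇ length B) (All.map ℕ.≤⇒≤ᵇ blocks-≥2))
    where
    open IsPartition part
    count : ∀ {i} → i ∈ range n → length (filterᵇ (elemᵇ i) F) ≡ 1
    count {i} i∈ with covering i∈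
    ... | B , B∈ , i∈B = length-filter≡1⇐ (T? ∘ elemᵇ i) partition-unique B∈ (∈⇒elemᵇ i∈B)
                           λ B′∈ i∈B′ → disjoint B′∈ B∈ (elemᵇ⇒∈ _ i∈B′) i∈B

isBlockᵇ : List ℕ → List ℕ → Bool
isBlockᵇ π B = any (λ s → reverse s ≡ᴸ B) (segments π)

isBlock⇔ : ∀ {π B} → T (isBlockᵇ π B) ⇔ reverse B ∈ segments π
isBlock⇔ {π} {B} = mk⇔ ⇒ ⇐
  where
  ⇒ : T (isBlockᵇ π B) → reverse B ∈ segments π
  ⇒ t with find (any⁻ _ (segments π) t)
  ... | s , s∈ , rev≡ with ≡ᴸ⇒≡ (reverse s) B rev≡
  ... | refl = subst (_∈ segments π) (sym (reverse-involutive s)) s∈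
  ⇐ : reverse B ∈ segments π → T (isBlockᵇ π B)
  ⇐ rev∈ = any⁺ (λ s → reverse s ≡ᴸ B)
    (lose rev∈ (subst (λ B′ → T (B′ ≡ᴸ B)) (sym (reverse-involutive B)) (≡⇒≡ᴸ B)))

endsAtᵇ : ℕ → List ℕ → Bool
endsAtᵇ m B = lastElem B ≡ᵇ m

blocksEndingAt : List (List ℕ) → ℕ → List (List ℕ)
blocksEndingAt F m = filterᵇ (endsAtᵇ m) F

blocksByMax : ℕ → List (List ℕ) → List (List ℕ)
blocksByMax n F = concatMap (blocksEndingAt F) (range n)

fromBlocks : ℕ → List (List ℕ) → List ℕ
fromBlocks n F = concatMap reverse (blocksByMax n F)

toBlocks : ℕ → List ℕ → List (List ℕ)
toBlocks n π = filterᵇ (isBlockᵇ π) (sublists (range n))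

module FromPartition {n F} (F⊑ : F ⊑ sublists (range n)) (part : IsPartition n F) where

  open IsPartition part

  block-increasing : ∀ {B} → B ∈ F → AllPairs _<_ B
  block-increasing B∈ = AllPairs-resp-⊑ (All.lookup blocks-⊑ B∈) (range-increasing n)

  block-nonempty : ∀ {B} → B ∈ F → 1 ≤ length B
  block-nonempty B∈ = ℕ.≤-trans (s≤s z≤n) (All.lookup blocks-≥2 B∈)

  ∈-blocksEndingAt⁻ : ∀ {m B} → B ∈ blocksEndingAt F m → B ∈ F × lastElem B ≡ m
  ∈-blocksEndingAt⁻ {m} {B} B∈ with ∈-filter⁻ (T? ∘ endsAtᵇ m) {xs = F} B∈
  ... | B∈F , last≡m = B∈F , ℕ.≡ᵇ⇒≡ (lastElem B) m last≡m

  ∈-blocksByMax⁺ : ∀ {B} → B ∈ F → B ∈ blocksByMax n F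
  ∈-blocksByMax⁺ {B} B∈ = ∈-concatMap⁺ (blocksEndingAt F)
    (Any.map (λ { refl → ∈-filter⁺ (T? ∘ endsAtᵇ _) B∈ (ℕ.≡⇒≡ᵇ (lastElem B) _ refl) })
             (Any-resp-⊆ (All.lookup blocks-⊑ B∈) (lastElem-∈ (block-nonempty B∈))))

  ∈-blocksByMax⁻ : ∀ {B} → B ∈ blocksByMax n F → B ∈ F
  ∈-blocksByMax⁻ B∈ with find (∈-concatMap⁻ (blocksEndingAt F) {xs = range n} B∈)
  ... | _ , _ , B∈m = proj₁ (∈-blocksEndingAt⁻ B∈m)

  blocksEndingAt-≤1 : ∀ m →
    blocksEndingAt F m ≡ [] ⊎ ∃[ B ] blocksEndingAt F m ≡ B ∷ [] × lastElem B ≡ m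
  blocksEndingAt-≤1 m with at-most-one (Unique.filter⁺ (T? ∘ endsAtᵇ m) (partition-unique {n} F⊑)) same
    where
    same : ∀ {B B′} → B ∈ blocksEndingAt F m → B′ ∈ blocksEndingAt F m → B ≡ B′
    same B∈ B′∈ with ∈-blocksEndingAt⁻ B∈ | ∈-blocksEndingAt⁻ B′∈
    ... | B∈F , last≡m | B′∈F , last′≡m = disjoint B∈F B′∈F (lastElem-∈ (block-nonempty B∈F))
      (subst (_∈ _) (trans last′≡m (sym last≡m)) (lastElem-∈ (block-nonempty B′∈F)))
  ... | inj₁ none      = inj₁ none
  ... | inj₂ (B , one) = inj₂ (B , one , proj₂ (∈-blocksEndingAt⁻ (subst (B ∈_) (sym one) (here refl))))

  map-lastElem-⊑ : ∀ ms → map lastElem (concatMap (blocksEndingAt F) ms) ⊑ ms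
  map-lastElem-⊑ [] = []
  map-lastElem-⊑ (m ∷ ms) rewrite map-++ lastElem (blocksEndingAt F m) (concatMap (blocksEndingAt F) ms)
    with blocksEndingAt-≤1 m
  ... | inj₁ none rewrite none = m ∷ʳ map-lastElem-⊑ ms
  ... | inj₂ (B , one , last≡m) rewrite one = last≡m ∷ map-lastElem-⊑ ms

  blocksByMax-increasing : AllPairs (_<_ on lastElem) (blocksByMax n F)
  blocksByMax-increasing = AllPairs.map⁻ (AllPairs-resp-⊑ (map-lastElem-⊑ (range n)) (range-increasing n))

  reversed-block-segment : ∀ {B} → B ∈ F → IsSegment (reverse B)
  reversed-block-segment {B} B∈ = decreasing⇒segment (AllPairs-reverse (block-increasing B∈))
    (subst (1 ≤_) (sym (length-reverse B)) (block-nonempty B∈))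

  segments-fromBlocks : segments (fromBlocks n F) ≡ map reverse (blocksByMax n F)
  segments-fromBlocks = segments-concat
    (All-map⁺ (All.tabulate (reversed-block-segment ∘ ∈-blocksByMax⁻)))
    (AllPairs.map⁺ blocksByMax-increasing)

  fromBlocks-good : Good (fromBlocks n F)
  fromBlocks-good = subst (All GoodSegment) (sym segments-fromBlocks)
    (All-map⁺ (All.tabulate (good ∘ ∈-blocksByMax⁻)))
    where
    good : ∀ {B} → B ∈ F → GoodSegment (reverse B)
    good {B} B∈ = subst (2 ≤_) (sym (length-reverse B)) (All.lookup blocks-≥2 B∈)
                , AllPairs-reverse (block-increasing B∈)

  fromBlocks-permutation : IsPermutation n (fromBlocks n F)
  fromBlocks-permutation = record
    { unique = Unique.concat⁺
        (All-map⁺ (All.tabulate λ B∈ →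
          AllPairs.map ℕ.>⇒≢ (AllPairs-reverse (block-increasing (∈-blocksByMax⁻ B∈)))))
        (AllPairs.map⁺ (AllPairs-map-∈ reversed-disjoint blocksByMax-increasing))
    ; ⊆range = λ x∈ → case find (∈-concatMap⁻ reverse {xs = blocksByMax n F} x∈) of λ where
        (B , B∈ , x∈B) → Any-resp-⊆ (All.lookup blocks-⊑ (∈-blocksByMax⁻ B∈)) (reverse⁻ x∈B)
    ; range⊆ = λ i∈ → case covering i∈ of λ where
        (B , B∈ , i∈B) → ∈-concatMap⁺ reverse (lose (∈-blocksByMax⁺ B∈) (reverse⁺ i∈B))
    }
    where
    reversed-disjoint : ∀ {B B′} → B ∈ blocksByMax n F → B′ ∈ blocksByMax n F →
      lastElem B < lastElem B′ → Disjoint (reverse B) (reverse B′)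
    reversed-disjoint B∈ B′∈ last< (i∈B , i∈B′)
      with disjoint (∈-blocksByMax⁻ B∈) (∈-blocksByMax⁻ B′∈) (reverse⁻ i∈B) (reverse⁻ i∈B′)
    ... | refl = ℕ.<-irrefl refl last<

  toBlocks-fromBlocks : toBlocks n (fromBlocks n F) ≡ F
  toBlocks-fromBlocks = filter-≡-sublist (T? ∘ isBlockᵇ (fromBlocks n F))
    F⊑ (sublists-unique (range-unique n)) block⇒∈ (All.tabulate ∈⇒block)
    where
    block⇒∈ : ∀ {B} → B ∈ sublists (range n) → T (isBlockᵇ (fromBlocks n F) B) → B ∈ F
    block⇒∈ {B} _ t
      with ∈-map⁻ reverse (subst (reverse B ∈_) segments-fromBlocks (to (isBlock⇔ {fromBlocks n F}) t))
    ... | B′ , B′∈ , rev≡ = subst (_∈ F) (sym (reverse-injective rev≡)) (∈-blocksByMax⁻ B′∈)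
    ∈⇒block : ∀ {B} → B ∈ F → T (isBlockᵇ (fromBlocks n F) B)
    ∈⇒block {B} B∈ = from (isBlock⇔ {fromBlocks n F})
      (subst (reverse B ∈_) (sym segments-fromBlocks) (∈-map⁺ reverse (∈-blocksByMax⁺ B∈)))

module FromGood {n π} (π∈ : π ∈ perms n) (good : Good π) where

  open IsPermutation (∈-perms⁻ {n} π∈)

  reversed-segment-⊑ : ∀ {s} → s ∈ segments π → reverse s ⊑ range n
  reversed-segment-⊑ s∈ = increasing-⊆⇒⊑
    (AllPairs-reverse (proj₂ (All.lookup good s∈))) (range-increasing n)
    (⊆range ∘ Any-resp-⊆ (segment-⊑ {π} s∈) ∘ reverse⁻)

  ∈-toBlocks⁻ : ∀ {B} → B ∈ toBlocks n π → reverse B ∈ segments π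
  ∈-toBlocks⁻ B∈ =
    to (isBlock⇔ {π}) (proj₂ (∈-filter⁻ (T? ∘ isBlockᵇ π) {xs = sublists (range n)} B∈))

  ∈-toBlocks⁺ : ∀ {B} → reverse B ∈ segments π → B ∈ toBlocks n π
  ∈-toBlocks⁺ {B} rev∈ = ∈-filter⁺ (T? ∘ isBlockᵇ π)
    (∈-sublists⁺ (subst (_⊑ range n) (reverse-involutive B) (reversed-segment-⊑ rev∈)))
    (from (isBlock⇔ {π}) rev∈)

  toBlocks-⊑ : toBlocks n π ⊑ sublists (range n)
  toBlocks-⊑ = filter-⊆ (T? ∘ isBlockᵇ π) (sublists (range n))

  toBlocks-partition : IsPartition n (toBlocks n π)
  toBlocks-partition = record
    { blocks-⊑  = All.tabulate (∈-sublists⁻ (range n) ∘ Any-resp-⊆ toBlocks-⊑)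
    ; blocks-≥2 = All.tabulate λ {B} B∈ →
        subst (2 ≤_) (length-reverse B) (proj₁ (All.lookup good (∈-toBlocks⁻ B∈)))
    ; covering  = λ i∈ → case ∈-segments (range⊆ i∈) of λ where
        (s , s∈ , i∈s) → reverse s
                       , ∈-toBlocks⁺ (subst (_∈ segments π) (sym (reverse-involutive s)) s∈)
                       , reverse⁺ i∈s
    ; disjoint  = λ B∈ B′∈ i∈B i∈B′ → reverse-injective
        (unique-concat⇒disjoint (subst Unique (sym (concat-segments π)) unique)
          (∈-toBlocks⁻ B∈) (∈-toBlocks⁻ B′∈) (reverse⁺ i∈B) (reverse⁺ i∈B′))
    }

  blocksByMax-toBlocks : blocksByMax n (toBlocks n π) ≡ map reverse (segments π)
  blocksByMax-toBlocks = ⊆-antisym-AllPairs ℕ.<-asym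
    (FromPartition.blocksByMax-increasing toBlocks-⊑ toBlocks-partition)
    (AllPairs.map⁺ (AllPairs.map (λ {s} {s′} → heads< {s} {s′}) (segments-increasing unique)))
    (λ B∈ → subst (_∈ _) (reverse-involutive _)
              (∈-map⁺ reverse (∈-toBlocks⁻ (FromPartition.∈-blocksByMax⁻ toBlocks-⊑ toBlocks-partition B∈))))
    (λ B∈ → case ∈-map⁻ reverse B∈ of λ where
       (s , s∈ , refl) → FromPartition.∈-blocksByMax⁺ toBlocks-⊑ toBlocks-partition
                           (∈-toBlocks⁺ (subst (_∈ segments π) (sym (reverse-involutive s)) s∈)))
    where
    heads< : ∀ {s s′} → hd s < hd s′ → lastElem (reverse s) < lastElem (reverse s′)
    heads< {s} {s′} =
      subst₂ (λ a b → hd a < hd b) (sym (reverse-involutive s)) (sym (reverse-involutive s′))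

  fromBlocks-toBlocks : fromBlocks n (toBlocks n π) ≡ π
  fromBlocks-toBlocks = begin
    concat (map reverse (blocksByMax n (toBlocks n π)))
      ≡⟨ cong (concat ∘ map reverse) blocksByMax-toBlocks ⟩
    concat (map reverse (map reverse (segments π)))
      ≡⟨ cong concat (sym (map-∘ (segments π))) ⟩
    concat (map (reverse ∘ reverse) (segments π))
      ≡⟨ cong concat (map-cong reverse-involutive (segments π)) ⟩
    concat (map (λ s → s) (segments π))
      ≡⟨ cong concat (map-id (segments π)) ⟩
    concat (segments π)
      ≡⟨ concat-segments π ⟩
    π ∎
    where open ≡-Reasoning

avoiders : ℕ → List (List ℕ)
avoiders n = filterᵇ (avoidsBothᵇ n) (perms n)

partitions : ℕ → List (List (List ℕ))
partitions n = filterᵇ (isPartitionᵇ n) (sublists (sublists (range n)))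

toBlocks-∈-partitions : ∀ {n π} → π ∈ avoiders n →
  toBlocks n π ∈ partitions n × fromBlocks n (toBlocks n π) ≡ π
toBlocks-∈-partitions {n} π∈ with ∈-filter⁻ (T? ∘ avoidsBothᵇ n) {xs = perms n} π∈
... | π∈perms , avoiding =
  ∈-filter⁺ (T? ∘ isPartitionᵇ n)
    (∈-sublists⁺ toBlocks-⊑) (partition⁺ toBlocks-⊑ toBlocks-partition)
  , fromBlocks-toBlocks
  where open FromGood {n} π∈perms (to (avoiders⇔good {n} π∈perms) avoiding)

fromBlocks-∈-avoiders : ∀ {n F} → F ∈ partitions n →
  fromBlocks n F ∈ avoiders n × toBlocks n (fromBlocks n F) ≡ F
fromBlocks-∈-avoiders {n} {F} F∈
  with ∈-filter⁻ (T? ∘ isPartitionᵇ n) {xs = sublists (sublists (range n))} F∈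
... | F∈sublists , partition =
  ∈-filter⁺ (T? ∘ avoidsBothᵇ n) fromBlocks∈perms
    (from (avoiders⇔good {n} fromBlocks∈perms) fromBlocks-good)
  , toBlocks-fromBlocks
  where
  F⊑ = ∈-sublists⁻ (sublists (range n)) F∈sublists
  open FromPartition {n} F⊑ (partition⁻ F⊑ partition)
  fromBlocks∈perms = ∈-perms⁺ {n} fromBlocks-permutation

theorem6p1 : (n : ℕ) → 1 ≤ n → numAvoiders n ≡ bell2 n
theorem6p1 n _ = length-≡-of-inverses (toBlocks n) (fromBlocks n)
  (Unique.filter⁺ _ (perms-unique n))
  (Unique.filter⁺ _ (sublists-unique (sublists-unique (range-unique n))))
  (toBlocks-∈-partitions {n}) (fromBlocks-∈-avoiders {n})
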